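{- In the setting below, let $T_{\min}$ be an addition tree over $X$ of minimum cost. If a node of $T_{\min}$ is a type-0 node, then its sibling (if it has one) is also a type-0 node; i.e., type-0 nodes can only be added to type-0 nodes.
   Context: Let $m,K$ be positive integers and $b_1,\ldots,b_{3m}$ positive integers with $K/4<b_i<K/2$ and $\sum_i b_i=mK$. Set $W=100(5m)^2K$, $a_i=b_i+W$, $L=3W+K$, $\varepsilon=1/(400(5m)^2)$, $h=\lfloor4\varepsilon L\rfloor$, $H=L+h$. Let $X$ be the multiset consisting of $a_1,\ldots,a_{3m}$, $m$ copies of $-H$ and $m$ copies of $h$. An addition tree over $X$ is a rooted full binary tree whose leaves are in bijection with the elements of $X$ (with multiplicity), labelled by them; a node's value is the sum of the labels of leaves in its subtree, and nodes are identified with their values; two sibling nodes are said to be added to each other. The cost is the sum of absolute values of internal nodes. Every node value $v$ of such a tree satisfies $|v/H-N/3|\le 1/(500m)$ for a unique integer $N$; we then say $v$ is of the form $(N/3+\lambda)H$ (with $|\lambda|\le1/(500m)$). A type-0 node is a node of the form $\lambda H$, i.e., with $N=0$. -}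

module Defs where

open import Data.Nat as ℕ using (ℕ; _+_; _*_; _^_; _/_; _<_; _≤_)
open import Data.Integer as ℤ using (ℤ; +_; -_; ∣_∣)
open import Data.Fin using (Fin)
import Data.Nat.Properties as NP
open import Data.List using (List; _∷_; []; map; sum; allFin; replicate; _++_)
open import Data.List.Relation.Binary.Permutation.Propositional using (_↭_)

data Tree : Set where
  leaf : ℤ → Tree
  node : Tree → Tree → Tree

leaves : Tree → List ℤ
leaves (leaf x)   = x ∷ []
leaves (node l r) = leaves l ++ leaves r

val : Tree → ℤ
val (leaf x)   = x
val (node l r) = val l ℤ.+ val r

cost : Tree → ℕ
cost (leaf _)   = 0
cost (node l r) = ∣ val l ℤ.+ val r ∣ + cost l + cost r

data _⊑_ : Tree → Tree → Set where
  here  : ∀ {t} → t ⊑ t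
  left  : ∀ {s l r} → s ⊑ l → s ⊑ node l r
  right : ∀ {s l r} → s ⊑ r → s ⊑ node l r

-- An addition tree over the multiset X (given as a list):
-- leaves are in bijection with the elements of X (with multiplicity).
IsAdditionTree : List ℤ → Tree → Set
IsAdditionTree X t = leaves t ↭ X

W : ℕ → ℕ → ℕ
W m K = 100 * (5 * m) ^ 2 * K

L : ℕ → ℕ → ℕ
L m K = 3 * W m K + K

-- h = ⌊4 ε L⌋ with ε = 1/(400 (5m)^2), i.e. h = ⌊L / (2500 m^2)⌋ (m > 0).
h : (m K : ℕ) → .{{ℕ.NonZero m}} → ℕ
h m K = L m K / (2500 * m * m)
  where instance _ : ℕ.NonZero (2500 * m * m)
                 _ = NP.m*n≢0 (2500 * m) m {{NP.m*n≢0 2500 m}}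

H : (m K : ℕ) → .{{ℕ.NonZero m}} → ℕ
H m K = L m K + h m K

Xs : (m K : ℕ) → .{{ℕ.NonZero m}} → (Fin (3 * m) → ℕ) → List ℤ
Xs m K b = map (λ i → + (b i + W m K)) (allFin (3 * m))
           ++ replicate m (- (+ H m K))
           ++ replicate m (+ h m K)

-- v is of type 0: v = λ H with |λ| ≤ 1/(500 m), i.e. 500 m |v| ≤ H.
Type0 : (m K : ℕ) → .{{ℕ.NonZero m}} → ℤ → Set
Type0 m K v = 500 * m * ∣ v ∣ ≤ H m K

{-# OPTIONS --safe #-}
module Submission where

open import Defs
open import Data.Nat using (ℕ; _+_; _*_; _<_; _≤_; NonZero)
open import Data.Fin using (Fin)
open import Data.Product using (_×_)
open import Data.List using (map; allFin)
open import Data.Nat.ListAction using (sum)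
open import Relation.Binary.PropositionalEquality using (_≡_)

open import Data.Nat using (suc; z≤n; s≤s; _⊔_; _/_; >-nonZero; >-nonZero⁻¹)
open import Data.Nat.Properties
  using ( ≤-refl; ≤-reflexive; ≤-trans; <-≤-trans; <⇒≤; <⇒≱; m≤m+n; m≤n+m; m<m+n; m≤m*n; m≤n*m
        ; +-comm; +-assoc; +-identityʳ; *-distribʳ-+; m*n≢0
        ; +-mono-≤; +-monoˡ-≤; +-monoʳ-≤; *-monoˡ-≤; *-monoʳ-≤; *-monoˡ-<; +-cancelˡ-≤; *-cancelˡ-≤
        ; ⊔-lub; module ≤-Reasoning )
open import Data.Nat.DivMod using (m/n*n≤m; m*n/n≡m; /-monoˡ-≤)
open import Data.Nat.Tactic.RingSolver using (solve-∀)
open import Data.Integer as ℤ using (ℤ; +_; -_; ∣_∣; 0ℤ; +0; +[1+_]; -[1+_]; _⊖_)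
import Data.Integer.Properties as ℤ
import Data.Integer.Tactic.RingSolver as ℤ-Solver
open import Data.Product using (_,_; proj₁; proj₂)
open import Data.Sum using (_⊎_; inj₁; inj₂)
open import Data.Empty using (⊥-elim)
open import Function using (id)
open import Data.List using (List; []; _∷_; _++_; length; foldr; replicate)
open import Data.List.Properties using (++-assoc; length-++; length-map; length-replicate; length-tabulate)
open import Data.List.Relation.Unary.All using (All; []; _∷_)
open import Data.List.Relation.Unary.All.Properties using (++⁺; ++⁻ˡ; ++⁻ʳ; map⁺; tabulate⁺; replicate⁺)
open import Data.List.Relation.Binary.Permutation.Propositional
  using (_↭_; ↭-refl; ↭-sym; ↭-trans; ↭⇒↭ₛ; module PermutationReasoning)
open import Data.List.Relation.Binary.Permutation.Propositional.Properties
  using (++⁺ˡ; ++⁺ʳ; ++-comm; ↭-length; All-resp-↭)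
import Data.List.Relation.Binary.Permutation.Setoid.Properties as ↭ₛ
open import Relation.Binary.PropositionalEquality
  using (refl; sym; trans; cong; cong₂; subst; subst₂; setoid; module ≡-Reasoning)

-- Let u be a type-0 child of the node u + w of T_min, at depth d < 5m. Replacing that node by w and
-- adding u at the root instead keeps the leaves, keeps the root value (the total, 0), changes each of
-- the d ancestors by at most |u| and deletes the node u + w; minimality thus gives |u + w| ≤ d |u|, so
-- |w| ≤ 5m |u| ≤ H/100.
-- Three times every leaf is within 3h of a multiple of H (3a_i ≈ H, 3(-H) = -3H, 3h ≈ 0), so 3w is
-- within 15mh ≤ 3H/(500m) of one. Being at most 3H/100, 3w must be near 0, i.e. w is of type 0.

depth : ∀ {s t} → s ⊑ t → ℕ
depth here      = 0
depth (left p)  = suc (depth p)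
depth (right p) = suc (depth p)

⊑-trans : ∀ {s t u} → s ⊑ t → t ⊑ u → s ⊑ u
⊑-trans p here      = p
⊑-trans p (left q)  = left (⊑-trans p q)
⊑-trans p (right q) = right (⊑-trans p q)

graft : ∀ {s t} → s ⊑ t → Tree → Tree
graft here      u = u
graft (left {r = r} p)  u = node (graft p u) r
graft (right {l = l} p) u = node l (graft p u)

val-graft : ∀ {s t} (p : s ⊑ t) u → val (graft p u) ≡ val t ℤ.- (val s ℤ.- val u)
val-graft {s} here u = graft-here (val s) (val u)
  where
  graft-here : ∀ x y → y ≡ x ℤ.- (x ℤ.- y)
  graft-here = ℤ-Solver.solve-∀
val-graft {s} (left {l = l} {r = r} p) u =
  trans (cong (λ x → x ℤ.+ val r) (val-graft p u)) (graft-left (val l) (val r) (val s ℤ.- val u))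
  where
  graft-left : ∀ x y δ → (x ℤ.- δ) ℤ.+ y ≡ (x ℤ.+ y) ℤ.- δ
  graft-left = ℤ-Solver.solve-∀
val-graft {s} (right {l = l} {r = r} p) u =
  trans (cong (λ y → val l ℤ.+ y) (val-graft p u)) (graft-right (val l) (val r) (val s ℤ.- val u))
  where
  graft-right : ∀ x y δ → x ℤ.+ (y ℤ.- δ) ≡ (x ℤ.+ y) ℤ.- δ
  graft-right = ℤ-Solver.solve-∀

∣val-graft∣ : ∀ {s t} (p : s ⊑ t) u → ∣ val (graft p u) ∣ ≤ ∣ val t ∣ + ∣ val s ℤ.- val u ∣
∣val-graft∣ {s} {t} p u =
  subst (λ x → ∣ x ∣ ≤ ∣ val t ∣ + ∣ val s ℤ.- val u ∣) (sym (val-graft p u)) (ℤ.∣i-j∣≤∣i∣+∣j∣ (val t) (val s ℤ.- val u))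

-- Every node on the path to the grafted position changes by val s - val u.
cost-graft : ∀ {s t} (p : s ⊑ t) u →
  cost (graft p u) + cost s ≤ cost t + cost u + depth p * ∣ val s ℤ.- val u ∣
cost-graft {s} here u = ≤-reflexive (swap (cost u) (cost s))
  where
  swap : ∀ a b → a + b ≡ b + a + 0
  swap = solve-∀
cost-graft {s} (left {l = l} {r = r} p) u = begin
  ∣ val (graft p u) ℤ.+ val r ∣ + cost (graft p u) + cost r + cost s
    ≡⟨ shuffle ∣ val (graft p u) ℤ.+ val r ∣ (cost (graft p u)) (cost r) (cost s) ⟩
  ∣ val (graft p u) ℤ.+ val r ∣ + cost r + (cost (graft p u) + cost s)
    ≤⟨ +-mono-≤ (+-monoˡ-≤ (cost r) (∣val-graft∣ (left {r = r} p) u)) (cost-graft p u) ⟩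
  ∣ val l ℤ.+ val r ∣ + ∣ δ ∣ + cost r + (cost l + cost u + depth p * ∣ δ ∣)
    ≡⟨ unshuffle ∣ val l ℤ.+ val r ∣ ∣ δ ∣ (cost r) (cost l) (cost u) (depth p) ⟩
  ∣ val l ℤ.+ val r ∣ + cost l + cost r + cost u + suc (depth p) * ∣ δ ∣ ∎
  where
  open ≤-Reasoning
  δ : ℤ
  δ = val s ℤ.- val u
  shuffle : ∀ a g c s → a + g + c + s ≡ a + c + (g + s)
  shuffle = solve-∀
  unshuffle : ∀ a e c l u d → a + e + c + (l + u + d * e) ≡ a + l + c + u + suc d * e
  unshuffle = solve-∀
cost-graft {s} (right {l = l} {r = r} p) u = begin
  ∣ val l ℤ.+ val (graft p u) ∣ + cost l + cost (graft p u) + cost s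
    ≡⟨ +-assoc (∣ val l ℤ.+ val (graft p u) ∣ + cost l) (cost (graft p u)) (cost s) ⟩
  ∣ val l ℤ.+ val (graft p u) ∣ + cost l + (cost (graft p u) + cost s)
    ≤⟨ +-mono-≤ (+-monoˡ-≤ (cost l) (∣val-graft∣ (right {l = l} p) u)) (cost-graft p u) ⟩
  ∣ val l ℤ.+ val r ∣ + ∣ δ ∣ + cost l + (cost r + cost u + depth p * ∣ δ ∣)
    ≡⟨ unshuffle ∣ val l ℤ.+ val r ∣ ∣ δ ∣ (cost l) (cost r) (cost u) (depth p) ⟩
  ∣ val l ℤ.+ val r ∣ + cost l + cost r + cost u + suc (depth p) * ∣ δ ∣ ∎
  where
  open ≤-Reasoning
  δ : ℤ
  δ = val s ℤ.- val u
  unshuffle : ∀ a e c r u d → a + e + c + (r + u + d * e) ≡ a + c + r + u + suc d * e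
  unshuffle = solve-∀

leaves-graft : ∀ {s t} (p : s ⊑ t) u {zs} → leaves s ↭ zs ++ leaves u → leaves t ↭ leaves (graft p u) ++ zs
leaves-graft here u {zs} s↭ = ↭-trans s↭ (++-comm zs (leaves u))
leaves-graft (left {l = l} {r = r} p) u {zs} s↭ = begin
  leaves l ++ leaves r                    ↭⟨ ++⁺ʳ (leaves r) (leaves-graft p u s↭) ⟩
  (leaves (graft p u) ++ zs) ++ leaves r  ≡⟨ ++-assoc (leaves (graft p u)) zs (leaves r) ⟩
  leaves (graft p u) ++ zs ++ leaves r    ↭⟨ ++⁺ˡ (leaves (graft p u)) (++-comm zs (leaves r)) ⟩
  leaves (graft p u) ++ leaves r ++ zs    ≡⟨ ++-assoc (leaves (graft p u)) (leaves r) zs ⟨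
  (leaves (graft p u) ++ leaves r) ++ zs  ∎
  where open PermutationReasoning
leaves-graft (right {l = l} {r = r} p) u {zs} s↭ = begin
  leaves l ++ leaves r                 ↭⟨ ++⁺ˡ (leaves l) (leaves-graft p u s↭) ⟩
  leaves l ++ leaves (graft p u) ++ zs ≡⟨ ++-assoc (leaves l) (leaves (graft p u)) zs ⟨
  (leaves l ++ leaves (graft p u)) ++ zs ∎
  where open PermutationReasoning

0<length-leaves : ∀ t → 0 < length (leaves t)
0<length-leaves (leaf _)   = s≤s z≤n
0<length-leaves (node l r) =
  ≤-trans (0<length-leaves l) (≤-trans (m≤m+n _ _) (≤-reflexive (sym (length-++ (leaves l)))))

depth+length≤length : ∀ {s t} (p : s ⊑ t) → depth p + length (leaves s) ≤ length (leaves t)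
depth+length≤length here = ≤-refl
depth+length≤length {s} (left {l = l} {r = r} p) = begin
  suc (depth p + length (leaves s))         ≡⟨ +-comm 1 _ ⟩
  depth p + length (leaves s) + 1           ≤⟨ +-mono-≤ (depth+length≤length p) (0<length-leaves r) ⟩
  length (leaves l) + length (leaves r)     ≡⟨ length-++ (leaves l) ⟨
  length (leaves l ++ leaves r)             ∎
  where open ≤-Reasoning
depth+length≤length {s} (right {l = l} {r = r} p) = begin
  suc (depth p + length (leaves s))         ≤⟨ +-mono-≤ (0<length-leaves l) (depth+length≤length p) ⟩
  length (leaves l) + length (leaves r)     ≡⟨ length-++ (leaves l) ⟨
  length (leaves l ++ leaves r)             ∎
  where open ≤-Reasoning

depth<length-leaves : ∀ {s t} (p : s ⊑ t) → depth p < length (leaves t)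
depth<length-leaves {s} p = <-≤-trans (m<m+n (depth p) (0<length-leaves s)) (depth+length≤length p)

length-leaves-⊑ : ∀ {s t} (p : s ⊑ t) → length (leaves s) ≤ length (leaves t)
length-leaves-⊑ p = ≤-trans (m≤n+m _ (depth p)) (depth+length≤length p)

All-leaves-⊑ : ∀ {P : ℤ → Set} {s t} → s ⊑ t → All P (leaves t) → All P (leaves s)
All-leaves-⊑ here      all = all
All-leaves-⊑ (left p)  all = All-leaves-⊑ p (++⁻ˡ _ all)
All-leaves-⊑ (right p) all = All-leaves-⊑ p (++⁻ʳ _ all)

sumℤ : List ℤ → ℤ
sumℤ = foldr ℤ._+_ 0ℤ

sumℤ-++ : ∀ xs ys → sumℤ (xs ++ ys) ≡ sumℤ xs ℤ.+ sumℤ ys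
sumℤ-++ []       ys = sym (ℤ.+-identityˡ (sumℤ ys))
sumℤ-++ (x ∷ xs) ys = trans (cong (λ z → x ℤ.+ z) (sumℤ-++ xs ys)) (sym (ℤ.+-assoc x (sumℤ xs) (sumℤ ys)))

sumℤ-↭ : ∀ {xs ys} → xs ↭ ys → sumℤ xs ≡ sumℤ ys
sumℤ-↭ xs↭ys = ↭ₛ.foldr-commMonoid (setoid ℤ) ℤ.+-0-isCommutativeMonoid (↭⇒↭ₛ xs↭ys)

val≡sumℤ-leaves : ∀ t → val t ≡ sumℤ (leaves t)
val≡sumℤ-leaves (leaf x)   = sym (ℤ.+-identityʳ x)
val≡sumℤ-leaves (node l r) =
  trans (cong₂ ℤ._+_ (val≡sumℤ-leaves l) (val≡sumℤ-leaves r)) (sym (sumℤ-++ (leaves l) (leaves r)))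

sumℤ-replicate : ∀ n x → sumℤ (replicate n x) ≡ + n ℤ.* x
sumℤ-replicate 0       x = sym (ℤ.*-zeroˡ x)
sumℤ-replicate (suc n) x = trans (cong (λ z → x ℤ.+ z) (sumℤ-replicate n x)) (sym (ℤ.suc-* (+ n) x))

sumℤ-map-+ : ∀ {A : Set} (f : A → ℕ) c xs →
  sumℤ (map (λ x → + (f x + c)) xs) ≡ + (sum (map f xs) + length xs * c)
sumℤ-map-+ f c []       = refl
sumℤ-map-+ f c (x ∷ xs) = begin
  + (f x + c) ℤ.+ sumℤ (map (λ x → + (f x + c)) xs)  ≡⟨ cong (λ z → + (f x + c) ℤ.+ z) (sumℤ-map-+ f c xs) ⟩
  + (f x + c) ℤ.+ + (sum (map f xs) + length xs * c)  ≡⟨ cong +_ (regroup (f x) c (sum (map f xs)) (length xs)) ⟩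
  + (f x + sum (map f xs) + suc (length xs) * c)      ∎
  where
  open ≡-Reasoning
  regroup : ∀ a c s n → a + c + (s + n * c) ≡ a + s + suc n * c
  regroup = solve-∀

length-allFin : ∀ n → length (allFin n) ≡ n
length-allFin n = length-tabulate id

CostMinimal : List ℤ → Tree → Set
CostMinimal X t = ∀ t′ → IsAdditionTree X t′ → cost t ≤ cost t′

module _ {X t} (t-over-X : IsAdditionTree X t) (t-minimal : CostMinimal X t) where

  -- Compare t with node (graft p u) v, which has the same leaves and root value.
  detach-bound : ∀ {s} (p : s ⊑ t) u v →
    leaves s ↭ leaves v ++ leaves u → val s ≡ val u ℤ.+ val v → cost s ≡ ∣ val s ∣ + cost u + cost v →
    ∣ val s ∣ ≤ ∣ val t ∣ + depth p * ∣ val v ∣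
  detach-bound {s} p u v s↭ val-s cost-s = +-cancelˡ-≤ (cost g + cost u + cost v) _ _ (begin
    cost g + cost u + cost v + ∣ val s ∣       ≡⟨ shuffle (cost g) (cost u) (cost v) ∣ val s ∣ ⟩
    cost g + (∣ val s ∣ + cost u + cost v)     ≡⟨ cong (λ c → cost g + c) cost-s ⟨
    cost g + cost s                            ≤⟨ cost-graft p u ⟩
    cost t + cost u + d * ∣ val s ℤ.- val u ∣  ≡⟨ cong (λ δ → cost t + cost u + d * ∣ δ ∣) s-u≡v ⟩
    cost t + cost u + d * ∣ val v ∣            ≤⟨ +-monoˡ-≤ _ (+-monoˡ-≤ (cost u) (t-minimal t′ t′-over-X)) ⟩
    cost t′ + cost u + d * ∣ val v ∣           ≡⟨ cong (λ x → ∣ x ∣ + cost g + cost v + cost u + d * ∣ val v ∣) val-t′ ⟩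
    ∣ val t ∣ + cost g + cost v + cost u + d * ∣ val v ∣
      ≡⟨ unshuffle ∣ val t ∣ (cost g) (cost v) (cost u) (d * ∣ val v ∣) ⟩
    cost g + cost u + cost v + (∣ val t ∣ + d * ∣ val v ∣) ∎)
    where
    open ≤-Reasoning
    d : ℕ
    d = depth p
    g : Tree
    g = graft p u
    t′ : Tree
    t′ = node g v
    s-u≡v : val s ℤ.- val u ≡ val v
    s-u≡v = trans (cong (λ x → x ℤ.- val u) val-s) (cancel (val u) (val v))
      where
      cancel : ∀ x y → (x ℤ.+ y) ℤ.- x ≡ y
      cancel = ℤ-Solver.solve-∀
    val-t′ : val g ℤ.+ val v ≡ val t
    val-t′ = trans (cong (λ x → x ℤ.+ val v) (trans (val-graft p u) (cong (λ δ → val t ℤ.- δ) s-u≡v)))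
                   (cancel (val t) (val v))
      where
      cancel : ∀ x y → (x ℤ.- y) ℤ.+ y ≡ x
      cancel = ℤ-Solver.solve-∀
    t′-over-X : IsAdditionTree X t′
    t′-over-X = ↭-trans (↭-sym (leaves-graft p u s↭)) t-over-X
    shuffle : ∀ a b c x → a + b + c + x ≡ a + (x + b + c)
    shuffle = solve-∀
    unshuffle : ∀ x a c b y → x + a + c + b + y ≡ a + b + c + (x + y)
    unshuffle = solve-∀

  sibling-bound : ∀ {l r} (p : node l r ⊑ t) →
    ∣ val l ∣ ≤ ∣ val t ∣ + suc (depth p) * ∣ val r ∣ × ∣ val r ∣ ≤ ∣ val t ∣ + suc (depth p) * ∣ val l ∣
  sibling-bound {l} {r} p =
      summand-bound (val l) (val r) (detach-bound p l r (++-comm (leaves l) (leaves r)) refl refl)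
    , summand-bound (val r) (val l)
        (subst (λ x → ∣ x ∣ ≤ ∣ val t ∣ + depth p * ∣ val l ∣) (ℤ.+-comm (val l) (val r))
          (detach-bound p r l ↭-refl (ℤ.+-comm (val l) (val r)) (swap-last ∣ val l ℤ.+ val r ∣ (cost l) (cost r))))
    where
    swap-last : ∀ a b c → a + b + c ≡ a + c + b
    swap-last = solve-∀
    summand-bound : ∀ x y → ∣ x ℤ.+ y ∣ ≤ ∣ val t ∣ + depth p * ∣ y ∣ → ∣ x ∣ ≤ ∣ val t ∣ + suc (depth p) * ∣ y ∣
    summand-bound x y x+y≤ = begin
      ∣ x ∣                                       ≡⟨ cong ∣_∣ (cancel x y) ⟩
      ∣ (x ℤ.+ y) ℤ.- y ∣                         ≤⟨ ℤ.∣i-j∣≤∣i∣+∣j∣ (x ℤ.+ y) y ⟩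
      ∣ x ℤ.+ y ∣ + ∣ y ∣                         ≤⟨ +-monoˡ-≤ ∣ y ∣ x+y≤ ⟩
      ∣ val t ∣ + depth p * ∣ y ∣ + ∣ y ∣         ≡⟨ rearrange (∣ val t ∣) (depth p) (∣ y ∣) ⟩
      ∣ val t ∣ + suc (depth p) * ∣ y ∣           ∎
      where
      open ≤-Reasoning
      cancel : ∀ x y → x ≡ (x ℤ.+ y) ℤ.- y
      cancel = ℤ-Solver.solve-∀
      rearrange : ∀ a d y → a + d * y + y ≡ a + suc d * y
      rearrange = solve-∀

record Near (g : ℤ) (e : ℕ) (x : ℤ) : Set where
  constructor near
  field
    multiple : ℤ
    distance : ∣ x ℤ.- multiple ℤ.* g ∣ ≤ e

near-weaken : ∀ {g e e′ x} → e ≤ e′ → Near g e x → Near g e′ x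
near-weaken e≤e′ (near n x≈) = near n (≤-trans x≈ e≤e′)

near-+ : ∀ {g e e′ x y} → Near g e x → Near g e′ y → Near g (e + e′) (x ℤ.+ y)
near-+ {g} {e} {e′} {x} {y} (near n x≈) (near n′ y≈) = near (n ℤ.+ n′) (begin
  ∣ x ℤ.+ y ℤ.- (n ℤ.+ n′) ℤ.* g ∣             ≡⟨ cong ∣_∣ (regroup x y n n′ g) ⟩
  ∣ (x ℤ.- n ℤ.* g) ℤ.+ (y ℤ.- n′ ℤ.* g) ∣     ≤⟨ ℤ.∣i+j∣≤∣i∣+∣j∣ (x ℤ.- n ℤ.* g) (y ℤ.- n′ ℤ.* g) ⟩
  ∣ x ℤ.- n ℤ.* g ∣ + ∣ y ℤ.- n′ ℤ.* g ∣       ≤⟨ +-mono-≤ x≈ y≈ ⟩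
  e + e′                                       ∎)
  where
  open ≤-Reasoning
  regroup : ∀ x y n n′ g → x ℤ.+ y ℤ.- (n ℤ.+ n′) ℤ.* g ≡ (x ℤ.- n ℤ.* g) ℤ.+ (y ℤ.- n′ ℤ.* g)
  regroup = ℤ-Solver.solve-∀

near-val : ∀ {g e} c t → All (λ x → Near g e (c ℤ.* x)) (leaves t) → Near g (length (leaves t) * e) (c ℤ.* val t)
near-val {e = e} c (leaf x) (x≈ ∷ []) = near-weaken (≤-reflexive (sym (+-identityʳ e))) x≈
near-val {g} {e} c (node l r) all =
  subst₂ (Near g) (sym lengths) (sym (ℤ.*-distribˡ-+ c (val l) (val r)))
    (near-+ (near-val c l (++⁻ˡ (leaves l) all)) (near-val c r (++⁻ʳ (leaves l) all)))
  where
  lengths : length (leaves l ++ leaves r) * e ≡ length (leaves l) * e + length (leaves r) * e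
  lengths = trans (cong (λ n → n * e) (length-++ (leaves l))) (*-distribʳ-+ e (length (leaves l)) _)

multiple-bound : ∀ {g e x} (x≈ : Near g e x) → ∣ Near.multiple x≈ ∣ * ∣ g ∣ ≤ ∣ x ∣ + e
multiple-bound {g} {e} {x} (near n x≈) = begin
  ∣ n ∣ * ∣ g ∣                        ≡⟨ ℤ.abs-* n g ⟨
  ∣ n ℤ.* g ∣                          ≡⟨ cong ∣_∣ (difference x (n ℤ.* g)) ⟩
  ∣ x ℤ.- (x ℤ.- n ℤ.* g) ∣            ≤⟨ ℤ.∣i-j∣≤∣i∣+∣j∣ x (x ℤ.- n ℤ.* g) ⟩
  ∣ x ∣ + ∣ x ℤ.- n ℤ.* g ∣            ≤⟨ +-monoʳ-≤ ∣ x ∣ x≈ ⟩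
  ∣ x ∣ + e                            ∎
  where
  open ≤-Reasoning
  difference : ∀ x y → y ≡ x ℤ.- (x ℤ.- y)
  difference = ℤ-Solver.solve-∀

near-small-or-far : ∀ {g e x} → Near g e x → ∣ x ∣ ≤ e ⊎ ∣ g ∣ ≤ ∣ x ∣ + e
near-small-or-far {g} {e} {x} (near +0 x≈) = inj₁ (subst (λ z → ∣ z ∣ ≤ e) (drop-zero x g) x≈)
  where
  drop-zero : ∀ x g → x ℤ.- 0ℤ ℤ.* g ≡ x
  drop-zero = ℤ-Solver.solve-∀
near-small-or-far {g} x≈@(near +[1+ n ] _) = inj₂ (≤-trans (m≤n*m ∣ g ∣ (suc n)) (multiple-bound x≈))
near-small-or-far {g} x≈@(near -[1+ n ] _) = inj₂ (≤-trans (m≤n*m ∣ g ∣ (suc n)) (multiple-bound x≈))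

type0-transfer-arith : ∀ m {H h u w} .{{_ : NonZero m}} → 0 < H → h * (2500 * m * m) ≤ H →
  500 * m * u ≤ H → w ≤ 5 * m * u → 3 * w ≤ 5 * m * (3 * h) ⊎ H ≤ 3 * w + 5 * m * (3 * h) →
  500 * m * w ≤ H
type0-transfer-arith m {H} {h} {w = w} _ h≤ _ _ (inj₁ 3w≤) = *-cancelˡ-≤ 3 (begin
  3 * (500 * m * w)            ≡⟨ regroup m w ⟩
  500 * m * (3 * w)            ≤⟨ *-monoʳ-≤ (500 * m) 3w≤ ⟩
  500 * m * (5 * m * (3 * h))  ≡⟨ regroup′ m h ⟩
  3 * (h * (2500 * m * m))     ≤⟨ *-monoʳ-≤ 3 h≤ ⟩
  3 * H                        ∎)
  where
  open ≤-Reasoning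
  regroup : ∀ m w → 3 * (500 * m * w) ≡ 500 * m * (3 * w)
  regroup = solve-∀
  regroup′ : ∀ m h → 500 * m * (5 * m * (3 * h)) ≡ 3 * (h * (2500 * m * m))
  regroup′ = solve-∀
type0-transfer-arith m {H} {h} {u} {w} 0<H h≤ u-type0 w≤ (inj₂ H≤) =
  ⊥-elim (<⇒≱ (*-monoˡ-< H {{>-nonZero 0<H}} (m<m+n 4 {96} (s≤s z≤n))) (begin
    100 * H                                ≤⟨ *-monoʳ-≤ 100 H≤ ⟩
    100 * (3 * w + 5 * m * (3 * h))        ≡⟨ regroup m w h ⟩
    3 * (100 * w) + 1500 * (m * h)         ≤⟨ +-mono-≤ (*-monoʳ-≤ 3 100w≤H) 1500mh≤H ⟩
    3 * H + H                              ≡⟨ +-comm (3 * H) H ⟩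
    4 * H                                  ∎))
  where
  open ≤-Reasoning
  regroup : ∀ m w h → 100 * (3 * w + 5 * m * (3 * h)) ≡ 3 * (100 * w) + 1500 * (m * h)
  regroup = solve-∀
  100w≤H : 100 * w ≤ H
  100w≤H = begin
    100 * w             ≤⟨ *-monoʳ-≤ 100 w≤ ⟩
    100 * (5 * m * u)   ≡⟨ regroup′ m u ⟩
    500 * m * u         ≤⟨ u-type0 ⟩
    H                   ∎
    where
    regroup′ : ∀ m u → 100 * (5 * m * u) ≡ 500 * m * u
    regroup′ = solve-∀
  1500mh≤H : 1500 * (m * h) ≤ H
  1500mh≤H = begin
    1500 * (m * h)         ≤⟨ *-monoˡ-≤ (m * h) (m≤m+n 1500 1000) ⟩
    2500 * (m * h)         ≤⟨ *-monoʳ-≤ 2500 (*-monoˡ-≤ h (m≤m*n m m)) ⟩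
    2500 * (m * m * h)     ≡⟨ regroup′ m h ⟩
    h * (2500 * m * m)     ≤⟨ h≤ ⟩
    H                      ∎
    where
    regroup′ : ∀ m h → 2500 * (m * m * h) ≡ h * (2500 * m * m)
    regroup′ = solve-∀

module Construction (m K : ℕ) .{{_ : NonZero m}} .{{_ : NonZero K}} (b : Fin (3 * m) → ℕ)
  (2b<K : ∀ i → 2 * b i < K) (Σb≡mK : sum (map b (allFin (3 * m))) ≡ m * K) where

  private instance
    2500m²≢0 : NonZero (2500 * m * m)
    2500m²≢0 = m*n≢0 (2500 * m) m {{m*n≢0 2500 m}}

  h*2500m²≤H : h m K * (2500 * m * m) ≤ H m K
  h*2500m²≤H = ≤-trans (m/n*n≤m (L m K) (2500 * m * m)) (m≤m+n (L m K) (h m K))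

  0<H : 0 < H m K
  0<H = ≤-trans (>-nonZero⁻¹ K) (≤-trans (m≤n+m K (3 * W m K)) (m≤m+n (L m K) (h m K)))

  K≤h : K ≤ h m K
  K≤h = begin
    K                                  ≡⟨ m*n/n≡m K (2500 * m * m) ⟨
    K * (2500 * m * m) / (2500 * m * m) ≤⟨ /-monoˡ-≤ (2500 * m * m) K*2500m²≤L ⟩
    h m K                              ∎
    where
    open ≤-Reasoning
    -- (5 * m) ^ 2 is unfolded because the solver does not handle _^_.
    W≡ : ∀ m K → K * (2500 * m * m) ≡ 100 * (5 * m * (5 * m * 1)) * K
    W≡ = solve-∀
    K*2500m²≤L : K * (2500 * m * m) ≤ L m K
    K*2500m²≤L = ≤-trans (≤-reflexive (W≡ m K)) (≤-trans (m≤m+n (W m K) _) (m≤m+n (3 * W m K) K))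

  b≤h : ∀ i → b i ≤ h m K
  b≤h i = ≤-trans (m≤m+n (b i) (b i + 0)) (≤-trans (<⇒≤ (2b<K i)) K≤h)

  Xs-length : length (Xs m K b) ≡ 5 * m
  Xs-length = begin
    length (as ++ replicate m (- + H m K) ++ replicate m (+ h m K))
      ≡⟨ length-++ as ⟩
    length as + length (replicate m (- + H m K) ++ replicate m (+ h m K))
      ≡⟨ cong₂ _+_ (trans (length-map _ (allFin (3 * m))) (length-allFin (3 * m)))
                   (trans (length-++ (replicate m (- + H m K))) (cong₂ _+_ (length-replicate m) (length-replicate m))) ⟩
    3 * m + (m + m)
      ≡⟨ regroup m ⟩
    5 * m ∎
    where
    open ≡-Reasoning
    as : List ℤ
    as = map (λ i → + (b i + W m K)) (allFin (3 * m))
    regroup : ∀ m → 3 * m + (m + m) ≡ 5 * m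
    regroup = solve-∀

  Xs-sum : sumℤ (Xs m K b) ≡ 0ℤ
  Xs-sum = begin
    sumℤ (as ++ replicate m (- + H m K) ++ replicate m (+ h m K))
      ≡⟨ trans (sumℤ-++ as _) (cong (λ z → sumℤ as ℤ.+ z) (sumℤ-++ (replicate m (- + H m K)) _)) ⟩
    sumℤ as ℤ.+ (sumℤ (replicate m (- + H m K)) ℤ.+ sumℤ (replicate m (+ h m K)))
      ≡⟨ cong₂ ℤ._+_ sum-as (cong₂ ℤ._+_ (sumℤ-replicate m (- + H m K)) (sumℤ-replicate m (+ h m K))) ⟩
    + A ℤ.+ (+ m ℤ.* - + H m K ℤ.+ + m ℤ.* + h m K)
      ≡⟨ cong (λ z → + A ℤ.+ (z ℤ.+ + m ℤ.* + h m K)) sum-negatives ⟩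
    + A ℤ.+ (- (+ A ℤ.+ + m ℤ.* + h m K) ℤ.+ + m ℤ.* + h m K)
      ≡⟨ cancel (+ A) (+ m ℤ.* + h m K) ⟩
    0ℤ ∎
    where
    open ≡-Reasoning
    as : List ℤ
    as = map (λ i → + (b i + W m K)) (allFin (3 * m))
    A : ℕ
    A = m * K + 3 * m * W m K
    sum-as : sumℤ as ≡ + A
    sum-as = trans (sumℤ-map-+ b (W m K) (allFin (3 * m)))
                   (cong₂ (λ s n → + (s + n * W m K)) Σb≡mK (length-allFin (3 * m)))
    mH≡A+mh : ∀ m K W h → m * (3 * W + K + h) ≡ m * K + 3 * m * W + m * h
    mH≡A+mh = solve-∀
    sum-negatives : + m ℤ.* - + H m K ≡ - (+ A ℤ.+ + m ℤ.* + h m K)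
    sum-negatives = begin
      + m ℤ.* - + H m K            ≡⟨ ℤ.neg-distribʳ-* (+ m) (+ H m K) ⟨
      - (+ m ℤ.* + H m K)          ≡⟨ cong -_ (ℤ.pos-* m (H m K)) ⟨
      - + (m * H m K)              ≡⟨ cong (λ n → - + n) (mH≡A+mh m K (W m K) (h m K)) ⟩
      - + (A + m * h m K)          ≡⟨ cong -_ (trans (ℤ.pos-+ A (m * h m K)) (cong (λ z → + A ℤ.+ z) (ℤ.pos-* m (h m K)))) ⟩
      - (+ A ℤ.+ + m ℤ.* + h m K)  ∎
    cancel : ∀ a c → a ℤ.+ (- (a ℤ.+ c) ℤ.+ c) ≡ 0ℤ
    cancel = ℤ-Solver.solve-∀

  Xs-near : All (λ x → Near (+ H m K) (3 * h m K) (+ 3 ℤ.* x)) (Xs m K b)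
  Xs-near = ++⁺ (map⁺ (tabulate⁺ (λ i → near-a (b≤h i))))
                (++⁺ (replicate⁺ m near-negH) (replicate⁺ m near-h))
    where
    near-a : ∀ {a} → a ≤ h m K → Near (+ H m K) (3 * h m K) (+ 3 ℤ.* + (a + W m K))
    near-a {a} a≤h = near (+ 1) (begin
      ∣ + 3 ℤ.* + (a + W m K) ℤ.- + 1 ℤ.* + H m K ∣  ≡⟨ cong ∣_∣ shifted ⟩
      ∣ (3 * a) ⊖ (K + h m K) ∣                      ≤⟨ ℤ.∣m⊝n∣≤m⊔n (3 * a) (K + h m K) ⟩
      3 * a ⊔ (K + h m K)                            ≤⟨ ⊔-lub (*-monoʳ-≤ 3 a≤h) (+-mono-≤ K≤h (m≤m+n (h m K) (h m K + 0))) ⟩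
      3 * h m K                                      ∎)
      where
      open ≤-Reasoning
      shifted : + 3 ℤ.* + (a + W m K) ℤ.- + 1 ℤ.* + H m K ≡ (3 * a) ⊖ (K + h m K)
      shifted = trans (cong₂ ℤ._-_ (sym (ℤ.pos-* 3 (a + W m K))) (ℤ.*-identityˡ (+ H m K)))
               (trans (ℤ.[+m]-[+n]≡m⊖n (3 * (a + W m K)) (H m K))
               (trans (cong₂ _⊖_ (regroup a (W m K)) (regroup′ (W m K) K (h m K)))
                      (ℤ.+-cancelˡ-⊖ (3 * W m K) (3 * a) (K + h m K))))
        where
        regroup : ∀ a W → 3 * (a + W) ≡ 3 * W + 3 * a
        regroup = solve-∀
        regroup′ : ∀ W K h → 3 * W + K + h ≡ 3 * W + (K + h)
        regroup′ = solve-∀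
    near-negH : Near (+ H m K) (3 * h m K) (+ 3 ℤ.* - + H m K)
    near-negH = near (- + 3) (subst (λ z → ∣ z ∣ ≤ 3 * h m K) (sym (cancel (+ H m K))) z≤n)
      where
      cancel : ∀ g → + 3 ℤ.* - g ℤ.- - + 3 ℤ.* g ≡ 0ℤ
      cancel = ℤ-Solver.solve-∀
    near-h : Near (+ H m K) (3 * h m K) (+ 3 ℤ.* + h m K)
    near-h = near 0ℤ (≤-reflexive (trans (cong ∣_∣ (drop-zero (+ 3 ℤ.* + h m K) (+ H m K))) (ℤ.abs-* (+ 3) (+ h m K))))
      where
      drop-zero : ∀ x g → x ℤ.- 0ℤ ℤ.* g ≡ x
      drop-zero = ℤ-Solver.solve-∀

  module _ {T} (T-over-X : IsAdditionTree (Xs m K b) T) where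

    val≡0 : val T ≡ 0ℤ
    val≡0 = trans (val≡sumℤ-leaves T) (trans (sumℤ-↭ T-over-X) Xs-sum)

    length-leaves≡5m : length (leaves T) ≡ 5 * m
    length-leaves≡5m = trans (↭-length T-over-X) Xs-length

    node-near : ∀ {s} → s ⊑ T → Near (+ H m K) (5 * m * (3 * h m K)) (+ 3 ℤ.* val s)
    node-near {s} p =
      near-weaken (*-monoˡ-≤ (3 * h m K) (≤-trans (length-leaves-⊑ p) (≤-reflexive length-leaves≡5m)))
        (near-val (+ 3) s (All-leaves-⊑ p (All-resp-↭ (↭-sym T-over-X) Xs-near)))

    sibling-bound-5m : ∀ {s} (p : s ⊑ T) {u w : ℕ} → w ≤ ∣ val T ∣ + suc (depth p) * u → w ≤ 5 * m * u
    sibling-bound-5m p {u} {w} w≤ = begin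
      w                                ≤⟨ w≤ ⟩
      ∣ val T ∣ + suc (depth p) * u    ≡⟨ cong (λ v → ∣ v ∣ + suc (depth p) * u) val≡0 ⟩
      suc (depth p) * u                ≤⟨ *-monoˡ-≤ u (≤-trans (depth<length-leaves p) (≤-reflexive length-leaves≡5m)) ⟩
      5 * m * u                        ∎
      where open ≤-Reasoning

  type0-transfer : ∀ u w → ∣ w ∣ ≤ 5 * m * ∣ u ∣ → Near (+ H m K) (5 * m * (3 * h m K)) (+ 3 ℤ.* w) →
    Type0 m K u → Type0 m K w
  type0-transfer u w w≤ w≈ u-type0 =
    type0-transfer-arith m {h = h m K} 0<H h*2500m²≤H u-type0 w≤
      (subst (λ a → a ≤ e ⊎ H m K ≤ a + e) (ℤ.abs-* (+ 3) w) (near-small-or-far w≈))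
    where
    e : ℕ
    e = 5 * m * (3 * h m K)

lemma2p5 : (m K : ℕ) → .{{_ : NonZero m}} → .{{_ : NonZero K}} →
    (b : Fin (3 * m) → ℕ) →
    (∀ i → K < 4 * b i) → (∀ i → 2 * b i < K) →
    sum (map b (allFin (3 * m))) ≡ m * K →
    (Tmin : Tree) → IsAdditionTree (Xs m K b) Tmin →
    (∀ T → IsAdditionTree (Xs m K b) T → cost Tmin ≤ cost T) →
    ∀ l r → node l r ⊑ Tmin →
    (Type0 m K (val l) → Type0 m K (val r)) × (Type0 m K (val r) → Type0 m K (val l))
lemma2p5 m K b _ 2b<K Σb≡mK T T-over-X T-minimal l r p =
    type0-transfer (val l) (val r) r≤5m∣l∣ (node-near T-over-X (⊑-trans (right here) p))
  , type0-transfer (val r) (val l) l≤5m∣r∣ (node-near T-over-X (⊑-trans (left here) p))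
  where
  open Construction m K b 2b<K Σb≡mK
  l≤5m∣r∣ : ∣ val l ∣ ≤ 5 * m * ∣ val r ∣
  l≤5m∣r∣ = sibling-bound-5m T-over-X p (proj₁ (sibling-bound T-over-X T-minimal p))
  r≤5m∣l∣ : ∣ val r ∣ ≤ 5 * m * ∣ val l ∣
  r≤5m∣l∣ = sibling-bound-5m T-over-X p (proj₂ (sibling-bound T-over-X T-minimal p))
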